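{- Let $G_0,G_1\in\mathbb{Z}$ with $\gcd(G_0,G_1)=1$, let $(G_n)_{n\ge0}$ satisfy $G_n=G_{n-1}+G_{n-2}$ for $n\ge2$, and set $\Delta_{G_0,G_1}=\gcd(G_0+G_2,\,G_1+G_3)$. Then $\Delta_{G_0,G_1}\in\{1,5\}$, and $$\gcd(G_n+G_{n+2},\,G_{n+1}+G_{n+3})=\Delta_{G_0,G_1}\quad\text{for all } n\ge0.$$ -}

module Defs where

open import Data.Nat using (ℕ; suc)
open import Data.Integer using (ℤ; _+_)
open import Data.Integer.GCD using (gcd)

Δ-at : (ℕ → ℤ) → ℕ → ℤ
Δ-at G n = gcd (G n + G (suc (suc n))) (G (suc n) + G (suc (suc (suc n))))

{-# OPTIONS --safe #-}
-- The shifted sums H n = G n + G (n + 2) again satisfy the Fibonacci recurrence, and the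
-- Euclidean step gcd(a, b) = gcd(b, b + a) makes the gcd of consecutive terms of any such
-- sequence constant. Moreover (H₀, H₁) = (2 G₀ + G₁, G₀ + 3 G₁) is a system of determinant 5,
-- so 5 G₀ = 3 H₀ - H₁ and 5 G₁ = 2 H₁ - H₀; hence Δ divides 5 gcd(G₀, G₁) = 5.
module Submission where

open import Defs
open import Data.Nat using (ℕ; suc)
open import Data.Integer using (ℤ; _+_; +_)
open import Data.Integer.GCD using (gcd)
open import Data.Sum using (_⊎_)
open import Data.Product using (_×_)
open import Relation.Binary.PropositionalEquality using (_≡_)

import Data.Nat as ℕ
import Data.Nat.Divisibility as ℕ
import Data.Nat.GCD as ℕ
open import Data.Nat.Primality using (Prime; prime?; prime⇒irreducible)
open import Data.Integer using (_*_; _-_; ∣_∣)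
open import Data.Integer.Properties using (∣i*j∣≡∣i∣*∣j∣; +-commutativeSemigroup)
open import Data.Integer.Divisibility.Signed
  using (∣ᵤ⇒∣; ∣⇒∣ᵤ; ∣m∣n⇒∣m+n; ∣m∣n⇒∣m-n; ∣m+n∣m⇒∣n; ∣n⇒∣m*n)
  renaming (_∣_ to _∣ₛ_)
import Data.Integer.Divisibility as Unsigned
import Data.Integer.GCD as ℤ
open import Data.Integer.Tactic.RingSolver using (solve-∀)
open import Algebra.Properties.CommutativeSemigroup +-commutativeSemigroup using (interchange)
open import Data.Sum using (map)
open import Data.Product using (_,_)
open import Relation.Nullary.Decidable using (toWitness)
open import Relation.Binary.PropositionalEquality using (refl; sym; cong; cong₂; subst; module ≡-Reasoning)

gcd-∣ₛˡ : ∀ i j → gcd i j ∣ₛ i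
gcd-∣ₛˡ i j = ∣ᵤ⇒∣ (ℤ.gcd[i,j]∣i i j)

gcd-∣ₛʳ : ∀ i j → gcd i j ∣ₛ j
gcd-∣ₛʳ i j = ∣ᵤ⇒∣ (ℤ.gcd[i,j]∣j i j)

gcd-greatestₛ : ∀ {i j k} → k ∣ₛ i → k ∣ₛ j → k ∣ₛ gcd i j
gcd-greatestₛ {i} {j} {k} k∣i k∣j = ∣ᵤ⇒∣ (ℤ.gcd-greatest {i} {j} {k} (∣⇒∣ᵤ k∣i) (∣⇒∣ᵤ k∣j))

gcd[i,j]≡gcd[j,j+i] : ∀ i j → gcd i j ≡ gcd j (j + i)
gcd[i,j]≡gcd[j,j+i] i j = cong +_ (ℕ.∣-antisym (∣⇒∣ᵤ g∣h) (∣⇒∣ᵤ h∣g))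
  where
  g∣h : gcd i j ∣ₛ gcd j (j + i)
  g∣h = gcd-greatestₛ (gcd-∣ₛʳ i j) (∣m∣n⇒∣m+n (gcd-∣ₛʳ i j) (gcd-∣ₛˡ i j))
  h∣g : gcd j (j + i) ∣ₛ gcd i j
  h∣g = gcd-greatestₛ (∣m+n∣m⇒∣n (gcd-∣ₛʳ j (j + i)) (gcd-∣ₛˡ j (j + i))) (gcd-∣ₛˡ j (j + i))

∣c*i∧∣c*j⇒∣c*gcd[i,j] : ∀ {k} c i j → k Unsigned.∣ c * i → k Unsigned.∣ c * j → k Unsigned.∣ c * gcd i j
∣c*i∧∣c*j⇒∣c*gcd[i,j] {k} c i j k∣ci k∣cj = subst (∣ k ∣ ℕ.∣_) (sym (∣i*j∣≡∣i∣*∣j∣ c (gcd i j))) k∣∣c∣*gcd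
  where
  k∣∣c∣*gcd : ∣ k ∣ ℕ.∣ ∣ c ∣ ℕ.* ℕ.gcd ∣ i ∣ ∣ j ∣
  k∣∣c∣*gcd = subst (∣ k ∣ ℕ.∣_) (sym (ℕ.c*gcd[m,n]≡gcd[cm,cn] (∣ c ∣) (∣ i ∣) (∣ j ∣)))
    (ℕ.gcd-greatest (subst (∣ k ∣ ℕ.∣_) (∣i*j∣≡∣i∣*∣j∣ c i) k∣ci)
                    (subst (∣ k ∣ ℕ.∣_) (∣i*j∣≡∣i∣*∣j∣ c j) k∣cj))

IsFibonacci : (ℕ → ℤ) → Set
IsFibonacci G = ∀ n → G (suc (suc n)) ≡ G (suc n) + G n

gcd-consecutive-invariant : ∀ H → IsFibonacci H → ∀ n → gcd (H n) (H (suc n)) ≡ gcd (H 0) (H 1)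
gcd-consecutive-invariant H H-fib 0       = refl
gcd-consecutive-invariant H H-fib (suc n) = begin
  gcd (H (suc n)) (H (suc (suc n)))  ≡⟨ cong (gcd (H (suc n))) (H-fib n) ⟩
  gcd (H (suc n)) (H (suc n) + H n)  ≡⟨ sym (gcd[i,j]≡gcd[j,j+i] (H n) (H (suc n))) ⟩
  gcd (H n) (H (suc n))              ≡⟨ gcd-consecutive-invariant H H-fib n ⟩
  gcd (H 0) (H 1)                    ∎
  where open ≡-Reasoning

companion : (ℕ → ℤ) → ℕ → ℤ
companion G n = G n + G (suc (suc n))

companion-isFibonacci : ∀ G → IsFibonacci G → IsFibonacci (companion G)
companion-isFibonacci G G-fib n = begin
  G (2 ℕ.+ n) + G (4 ℕ.+ n)                             ≡⟨ cong₂ _+_ (G-fib n) (G-fib (2 ℕ.+ n)) ⟩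
  (G (1 ℕ.+ n) + G n) + (G (3 ℕ.+ n) + G (2 ℕ.+ n))     ≡⟨ interchange (G (1 ℕ.+ n)) (G n) (G (3 ℕ.+ n)) (G (2 ℕ.+ n)) ⟩
  (G (1 ℕ.+ n) + G (3 ℕ.+ n)) + (G n + G (2 ℕ.+ n))     ∎
  where open ≡-Reasoning

companion-inverts : ∀ G → IsFibonacci G →
  (+ 3 * companion G 0 - companion G 1 ≡ + 5 * G 0) × (+ 2 * companion G 1 - companion G 0 ≡ + 5 * G 1)
companion-inverts G G-fib rewrite G-fib 1 | G-fib 0 = first (G 0) (G 1) , second (G 0) (G 1)
  where
  first : ∀ a b → + 3 * (a + (b + a)) - (b + ((b + a) + b)) ≡ + 5 * a
  first = solve-∀
  second : ∀ a b → + 2 * (b + ((b + a) + b)) - (a + (b + a)) ≡ + 5 * b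
  second = solve-∀

∣Δ-at∣∣5 : ∀ G → IsFibonacci G → gcd (G 0) (G 1) ≡ + 1 → ∣ Δ-at G 0 ∣ ℕ.∣ 5
∣Δ-at∣∣5 G G-fib coprime = subst (λ g → Δ Unsigned.∣ + 5 * g) coprime Δ∣5*gcd
  where
  H = companion G
  Δ = Δ-at G 0
  Δ∣H₀ : Δ ∣ₛ H 0
  Δ∣H₀ = gcd-∣ₛˡ (H 0) (H 1)
  Δ∣H₁ : Δ ∣ₛ H 1
  Δ∣H₁ = gcd-∣ₛʳ (H 0) (H 1)
  Δ∣difference : ∀ {c i x} → c - i ≡ x → Δ ∣ₛ c → Δ ∣ₛ i → Δ Unsigned.∣ x
  Δ∣difference eq Δ∣c Δ∣i = ∣⇒∣ᵤ (subst (Δ ∣ₛ_) eq (∣m∣n⇒∣m-n Δ∣c Δ∣i))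
  Δ∣5*gcd : Δ Unsigned.∣ + 5 * gcd (G 0) (G 1)
  Δ∣5*gcd with companion-inverts G G-fib
  ... | eq₀ , eq₁ = ∣c*i∧∣c*j⇒∣c*gcd[i,j] {Δ} (+ 5) (G 0) (G 1)
    (Δ∣difference eq₀ (∣n⇒∣m*n (+ 3) Δ∣H₀) Δ∣H₁)
    (Δ∣difference eq₁ (∣n⇒∣m*n (+ 2) Δ∣H₁) Δ∣H₀)

prime[5] : Prime 5
prime[5] = toWitness {a? = prime? 5} _

lemma4p6 : (G : ℕ → ℤ) → gcd (G 0) (G 1) ≡ + 1
    → (∀ n → G (suc (suc n)) ≡ G (suc n) + G n)
    → (Δ-at G 0 ≡ + 1 ⊎ Δ-at G 0 ≡ + 5) × (∀ n → Δ-at G n ≡ Δ-at G 0)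
lemma4p6 G coprime G-fib =
  map (cong (λ n → + n)) (cong (λ n → + n)) (prime⇒irreducible prime[5] (∣Δ-at∣∣5 G G-fib coprime)) ,
  gcd-consecutive-invariant (companion G) (companion-isFibonacci G G-fib)
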